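{- For a skew gain graph $\Phi_f=(G,F^\times,\varphi,f)$, $L_g(\Phi_f)=\mathrm{H}(\Phi_f)\,\mathrm{H}^{\#}(\Phi_f)$.
   Context: $F$ is a field of characteristic zero with algebraic closure $\overline F$; $f:F^\times\to F^\times$ is an involutive automorphism and $g(x)=xf(x)$. $G$ is a finite simple graph with vertices $v_1,\dots,v_n$ and edges $\overrightarrow{e_1},\dots,\overrightarrow{e_m}$, each with a fixed orientation; for $\overrightarrow{e_j}=\overrightarrow{v_iv_k}$, $t(\overrightarrow{e_j})=v_i$ is its tail and $h(\overrightarrow{e_j})=v_k$ its head. A skew gain graph $\Phi_f$ assigns gains $\varphi(\overrightarrow{uv})\in F^\times$ with $\varphi(\overrightarrow{vu})=f(\varphi(\overrightarrow{uv}))$. Adjacency matrix: $A(\Phi_f)=(a_{ij})$, $a_{ij}=\varphi(\overrightarrow{v_iv_j})$ if $v_i\sim v_j$, else $0$. For each edge fix a square root $\sqrt{g(\varphi(\overrightarrow{e_j}))}\in\overline F$ (with $\varphi(\overrightarrow{e_j})$ the gain in the fixed orientation); these same choices are used throughout. The $g$-degree matrix is $D_g(\Phi_f)=\mathrm{diag}\big(\sum_{\overrightarrow{e}:v_i\sim\overrightarrow{e}}\sqrt{g(\varphi(\overrightarrow{e}))}\big)_{i=1}^n$ (sum over edges incident to $v_i$) and the $g$-Laplacian is $L_g(\Phi_f)=D_g(\Phi_f)-A(\Phi_f)$. The incidence matrix $\mathrm{H}(\Phi_f)=(b_{ij})$ is $n\times m$ with $b_{ij}=g(\varphi(\overrightarrow{e_j}))$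 if $t(\overrightarrow{e_j})=v_i$, $b_{ij}=-f(\varphi(\overrightarrow{e_j}))\sqrt{g(\varphi(\overrightarrow{e_j}))}$ if $h(\overrightarrow{e_j})=v_i$, and $0$ otherwise. $\mathrm{H}^{\#}(\Phi_f)$ is the $m\times n$ matrix obtained from $\mathrm{H}(\Phi_f)$ by replacing each entry $g(\varphi(\overrightarrow{e_j}))$ by $(\sqrt{g(\varphi(\overrightarrow{e_j}))})^{ -1}$ and each entry $-f(\varphi(\overrightarrow{e_j}))\sqrt{g(\varphi(\overrightarrow{e_j}))}$ by $-(f(\varphi(\overrightarrow{e_j})))^{ -1}$ (zeros kept), and then transposing. -}

module Defs where

open import Level using (Level; _⊔_) renaming (suc to lsuc)
open import Data.Nat using (ℕ; zero; suc)
open import Data.Fin using (Fin; zero; suc; fromℕ; _≟_)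
open import Data.Product using (Σ; ∃; _×_; _,_; proj₁; proj₂)
open import Data.Sum using (_⊎_)
open import Relation.Nullary using (¬_; Dec; yes; no)
open import Relation.Binary.PropositionalEquality using (_≡_)
open import Algebra.Bundles using (CommutativeRing)
open import Algebra.Morphism.Structures using (module RingMorphisms)

-- Fields: a commutative ring with 1 ≉ 0 and inverses of nonzero elements.
-- The inverse is a total operation; its value at 0 is irrelevant (junk).
record Field (c ℓ : Level) : Set (lsuc (c ⊔ ℓ)) where
  field
    commutativeRing : CommutativeRing c ℓ
  open CommutativeRing commutativeRing public
  field
    _⁻¹ : Carrier → Carrier
    ⁻¹-inverse : ∀ x → ¬ (x ≈ 0#) → (x * (x ⁻¹)) ≈ 1#
    1≉0 : ¬ (1# ≈ 0#)

module FieldOps {c ℓ : Level} (K : Field c ℓ) where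
  open Field K using (Carrier; _+_; _*_; 0#; 1#)

  ∑ : (m : ℕ) → (Fin m → Carrier) → Carrier
  ∑ zero    h = 0#
  ∑ (suc m) h = h zero + ∑ m (λ j → h (suc j))

  _^_ : Carrier → ℕ → Carrier
  x ^ zero  = 1#
  x ^ suc k = x * (x ^ k)

  natMul : ℕ → Carrier
  natMul zero    = 0#
  natMul (suc k) = 1# + natMul k

  evalPoly : (d : ℕ) → (Fin (suc d) → Carrier) → Carrier → Carrier
  evalPoly d a x = ∑ (suc d) (λ i → a i * (x ^ Data.Fin.toℕ i))

open FieldOps public

CharZero : ∀ {c ℓ} → Field c ℓ → Set ℓ
CharZero F = ∀ k → ¬ (natMul F (suc k) ≈ 0#)
  where open Field F using (_≈_; 0#)

IsAlgClosed : ∀ {c ℓ} → Field c ℓ → Set (c ⊔ ℓ)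
IsAlgClosed K = ∀ (d : ℕ) (a : Fin (suc (suc d)) → Carrier) →
  ¬ (a (fromℕ (suc d)) ≈ 0#) → ∃ λ x → evalPoly K (suc d) a x ≈ 0#
  where open Field K using (Carrier; _≈_; 0#)

record IsAlgebraicClosure {c ℓ c' ℓ'} (F : Field c ℓ) (K : Field c' ℓ')
       (ι : Field.Carrier F → Field.Carrier K) : Set (c ⊔ ℓ ⊔ c' ⊔ ℓ') where
  module F = Field F
  module K = Field K
  field
    ι-hom     : RingMorphisms.IsRingHomomorphism F.rawRing K.rawRing ι
    algClosed : IsAlgClosed K
    algebraic : ∀ (y : K.Carrier) → ∃ λ (d : ℕ) → Σ (Fin (suc d) → F.Carrier) λ a →
                  (∃ λ i → ¬ (a i F.≈ F.0#)) × (evalPoly K d (λ i → ι (a i)) y K.≈ K.0#)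

-- An involutive automorphism f of the multiplicative group F^×,
-- represented as a map on F whose behaviour on nonzero elements matters.
record IsInvolutiveUnitAut {c ℓ} (F : Field c ℓ) (f : Field.Carrier F → Field.Carrier F)
       : Set (c ⊔ ℓ) where
  open Field F using (Carrier; _≈_; _*_; 0#)
  field
    f-cong    : ∀ {x y} → ¬ (x ≈ 0#) → x ≈ y → f x ≈ f y
    f-unit    : ∀ x → ¬ (x ≈ 0#) → ¬ (f x ≈ 0#)
    f-hom     : ∀ x y → ¬ (x ≈ 0#) → ¬ (y ≈ 0#) → f (x * y) ≈ (f x * f y)
    f-involut : ∀ x → ¬ (x ≈ 0#) → f (f x) ≈ x

gmap : ∀ {c ℓ} (F : Field c ℓ) → (Field.Carrier F → Field.Carrier F) →
       Field.Carrier F → Field.Carrier F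
gmap F f x = x * f x
  where open Field F using (_*_)

record SimpleGraph (n : ℕ) : Set₁ where
  field
    Adj     : Fin n → Fin n → Set
    adj?    : ∀ i k → Dec (Adj i k)
    adj-sym : ∀ {i k} → Adj i k → Adj k i
    irrefl  : ∀ i → ¬ Adj i i

record OrientedEdges {n : ℕ} (G : SimpleGraph n) (m : ℕ) : Set where
  open SimpleGraph G
  field
    tl hd    : Fin m → Fin n
    edge-adj : ∀ j → Adj (tl j) (hd j)
    edge-inj : ∀ j j' → (tl j ≡ tl j' × hd j ≡ hd j') ⊎ (tl j ≡ hd j' × hd j ≡ tl j') → j ≡ j'
    edge-sur : ∀ i k → Adj i k → ∃ λ j → (tl j ≡ i × hd j ≡ k) ⊎ (tl j ≡ k × hd j ≡ i)

-- Skew gain graph Φ_f on G: gains φ(v_i v_k) ∈ F^× for adjacent i, k,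
-- with φ(v_k v_i) = f(φ(v_i v_k)).  (Values at non-adjacent pairs are unused.)
record SkewGain {c ℓ} (F : Field c ℓ) (f : Field.Carrier F → Field.Carrier F)
       {n : ℕ} (G : SimpleGraph n) : Set (c ⊔ ℓ) where
  open Field F using (Carrier; _≈_; 0#)
  open SimpleGraph G
  field
    φ         : Fin n → Fin n → Carrier
    φ-nonzero : ∀ {i k} → Adj i k → ¬ (φ i k ≈ 0#)
    φ-skew    : ∀ {i k} → Adj i k → φ k i ≈ f (φ i k)

module SkewGainMatrices
  {c ℓ c' ℓ'} (F : Field c ℓ) (K : Field c' ℓ') (ι : Field.Carrier F → Field.Carrier K)
  (f : Field.Carrier F → Field.Carrier F)
  {n : ℕ} (G : SimpleGraph n) (Φ : SkewGain F f G) {m : ℕ} (E : OrientedEdges G m)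
  -- chosen square roots  sq j = √(g(φ(e_j))) ∈ K
  (sq : Fin m → Field.Carrier K)
  where
  private
    module F = Field F
  open Field K using (Carrier; _≈_; _+_; _*_; _-_; -_; 0#; 1#; _⁻¹)
  open SimpleGraph G
  open SkewGain Φ
  open OrientedEdges E

  Matrix : ℕ → ℕ → Set c'
  Matrix r s = Fin r → Fin s → Carrier

  φe : Fin m → F.Carrier
  φe j = φ (tl j) (hd j)

  adjacency : Matrix n n
  adjacency i k with adj? i k
  ... | yes _ = ι (φ i k)
  ... | no  _ = 0#

  incidentSq : Fin n → Fin m → Carrier
  incidentSq i j with tl j ≟ i | hd j ≟ i
  ... | yes _ | _     = sq j
  ... | no _  | yes _ = sq j
  ... | no _  | no _  = 0#

  degree : Matrix n n
  degree i k with i ≟ k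
  ... | yes _ = ∑ K m (incidentSq i)
  ... | no  _ = 0#

  laplacian : Matrix n n
  laplacian i k = degree i k - adjacency i k

  incidence : Matrix n m
  incidence i j with tl j ≟ i | hd j ≟ i
  ... | yes _ | _     = ι (gmap F f (φe j))
  ... | no _  | yes _ = (- ι (f (φe j))) * sq j
  ... | no _  | no _  = 0#

  incidence# : Matrix m n
  incidence# j i with tl j ≟ i | hd j ≟ i
  ... | yes _ | _     = sq j ⁻¹
  ... | no _  | yes _ = - ι ((f (φe j)) F.⁻¹)
  ... | no _  | no _  = 0#

  _⊗_ : ∀ {r s t} → Matrix r s → Matrix s t → Matrix r t
  _⊗_ {s = s} P Q i k = ∑ K s (λ j → P i j * Q j k)

  _≋_ : ∀ {r s} → Matrix r s → Matrix r s → Set ℓ'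
  P ≋ Q = ∀ i k → P i k ≈ Q i k

-- Column j of H pairs only with row j of H#, and that pairing is supported on the two
-- endpoints of e_j.  Hence the (i,k) entry of H H# is a sum over the edges incident to
-- both v_i and v_k: for i = k each incident edge contributes √g(φ(e_j)) (the diagonal of
-- D_g), for i ≠ k the unique edge joining v_i and v_k (if any) contributes -φ(v_i v_k),
-- the sign being carried by the head entries of both H and H#.
module Submission where

open import Defs
open import Level using (Level)
open import Data.Nat using (ℕ; zero; suc)
open import Data.Fin using (Fin; zero; suc; _≟_)
open import Data.Fin.Properties using (suc-injective)
open import Data.Product using (_×_; _,_)
open import Data.Sum using (_⊎_; inj₁; inj₂)
open import Data.Empty using (⊥-elim)
open import Function.Base using (_∘′_)
open import Relation.Nullary using (¬_; yes; no)
open import Relation.Binary.PropositionalEquality as ≡ using (_≡_; _≢_; cong₂)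
open import Algebra.Morphism.Structures using (module RingMorphisms)
import Algebra.Properties.Ring as RingProperties
import Relation.Binary.Reasoning.Setoid as SetoidReasoning

module FieldProperties {c ℓ : Level} (K : Field c ℓ) where
  open Field K hiding (zero)
  open RingProperties ring
  open SetoidReasoning setoid

  x≉0∧y≉0⇒xy≉0 : ∀ {x y} → ¬ x ≈ 0# → ¬ y ≈ 0# → ¬ x * y ≈ 0#
  x≉0∧y≉0⇒xy≉0 {x} {y} x≉0 y≉0 xy≈0 = y≉0 (begin
    y                  ≈⟨ *-identityˡ y ⟨
    1# * y             ≈⟨ *-congʳ (trans (*-comm (x ⁻¹) x) (⁻¹-inverse x x≉0)) ⟨
    (x ⁻¹ * x) * y     ≈⟨ *-assoc (x ⁻¹) x y ⟩
    x ⁻¹ * (x * y)     ≈⟨ *-congˡ xy≈0 ⟩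
    x ⁻¹ * 0#          ≈⟨ zeroʳ (x ⁻¹) ⟩
    0#                 ∎)

  s*s≈a∧a≉0⇒s≉0 : ∀ {s a} → s * s ≈ a → ¬ a ≈ 0# → ¬ s ≈ 0#
  s*s≈a∧a≉0⇒s≉0 {s} s*s≈a a≉0 s≈0 =
    a≉0 (trans (sym s*s≈a) (trans (*-congʳ s≈0) (zeroˡ s)))

  s*t≈1⇒[x*s]*t≈x : ∀ {s t} x → s * t ≈ 1# → (x * s) * t ≈ x
  s*t≈1⇒[x*s]*t≈x {s} {t} x s*t≈1 = begin
    (x * s) * t  ≈⟨ *-assoc x s t ⟩
    x * (s * t)  ≈⟨ *-congˡ s*t≈1 ⟩
    x * 1#       ≈⟨ *-identityʳ x ⟩
    x            ∎

  [-x*s]*-t≈[x*s]*t : ∀ x s t → ((- x) * s) * (- t) ≈ (x * s) * t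
  [-x*s]*-t≈[x*s]*t x s t = begin
    ((- x) * s) * (- t)  ≈⟨ *-congʳ (-‿distribˡ-* x s) ⟨
    (- (x * s)) * (- t)  ≈⟨ -‿distribʳ-* (- (x * s)) t ⟨
    - ((- (x * s)) * t)  ≈⟨ -‿cong (-‿distribˡ-* (x * s) t) ⟨
    - (- ((x * s) * t))  ≈⟨ -‿involutive ((x * s) * t) ⟩
    (x * s) * t          ∎

  a*b≈1⇒[-a*s]*-b≈s : ∀ {a b} s → a * b ≈ 1# → ((- a) * s) * (- b) ≈ s
  a*b≈1⇒[-a*s]*-b≈s {a} {b} s a*b≈1 = begin
    ((- a) * s) * (- b)  ≈⟨ [-x*s]*-t≈[x*s]*t a s b ⟩
    (a * s) * b          ≈⟨ *-congʳ (*-comm a s) ⟩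
    (s * a) * b          ≈⟨ s*t≈1⇒[x*s]*t≈x s a*b≈1 ⟩
    s                    ∎

  s*t≈1⇒[x*s]*-t≈-x : ∀ {s t} x → s * t ≈ 1# → (x * s) * (- t) ≈ - x
  s*t≈1⇒[x*s]*-t≈-x {s} {t} x s*t≈1 = begin
    (x * s) * (- t)  ≈⟨ -‿distribʳ-* (x * s) t ⟨
    - ((x * s) * t)  ≈⟨ -‿cong (s*t≈1⇒[x*s]*t≈x x s*t≈1) ⟩
    - x              ∎

  x-0≈x : ∀ x → x - 0# ≈ x
  x-0≈x x = trans (+-congˡ -0#≈0#) (+-identityʳ x)

  ∑-cong : ∀ {m} {h h′ : Fin m → Carrier} → (∀ j → h j ≈ h′ j) → ∑ K m h ≈ ∑ K m h′
  ∑-cong {zero}  h≈h′ = refl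
  ∑-cong {suc m} h≈h′ = +-cong (h≈h′ zero) (∑-cong (λ j → h≈h′ (suc j)))

  ∑-0 : ∀ {m} {h : Fin m → Carrier} → (∀ j → h j ≈ 0#) → ∑ K m h ≈ 0#
  ∑-0 {zero}  h≈0 = refl
  ∑-0 {suc m} h≈0 = trans (+-cong (h≈0 zero) (∑-0 (λ j → h≈0 (suc j)))) (+-identityˡ 0#)

  ∑-single : ∀ {m} {h : Fin m → Carrier} j₀ → (∀ j → j ≢ j₀ → h j ≈ 0#) → ∑ K m h ≈ h j₀
  ∑-single {suc m} {h} zero h≈0 =
    trans (+-congˡ (∑-0 (λ j → h≈0 (suc j) λ ()))) (+-identityʳ (h zero))
  ∑-single {suc m} (suc j₀) h≈0 =
    trans (+-congʳ (h≈0 zero λ ())) (trans (+-identityˡ _)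
      (∑-single j₀ (λ j j≢j₀ → h≈0 (suc j) (j≢j₀ ∘′ suc-injective))))

module RingHomomorphismProperties
  {c ℓ c′ ℓ′ : Level} (F : Field c ℓ) (K : Field c′ ℓ′) {ι : Field.Carrier F → Field.Carrier K}
  (ι-hom : RingMorphisms.IsRingHomomorphism (Field.rawRing F) (Field.rawRing K) ι) where
  private module F = Field F
  open Field K
  open RingMorphisms.IsRingHomomorphism ι-hom

  ι-inverse : ∀ {x} → ¬ x F.≈ F.0# → ι x * ι (x F.⁻¹) ≈ 1#
  ι-inverse {x} x≉0 = trans (sym (*-homo x (x F.⁻¹))) (trans (⟦⟧-cong (F.⁻¹-inverse x x≉0)) 1#-homo)

  ι-nonzero : ∀ {x} → ¬ x F.≈ F.0# → ¬ ι x ≈ 0#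
  ι-nonzero x≉0 ιx≈0 = 1≉0 (trans (sym (ι-inverse x≉0)) (trans (*-congʳ ιx≈0) (zeroˡ _)))

module EdgeProperties {n : ℕ} (G : SimpleGraph n) {m : ℕ} (E : OrientedEdges G m) where
  open SimpleGraph G
  open OrientedEdges E

  Joins : Fin n → Fin n → Fin m → Set
  Joins i k j = (tl j ≡ i × hd j ≡ k) ⊎ (tl j ≡ k × hd j ≡ i)

  joins-unique : ∀ {i k j j′} → Joins i k j → Joins i k j′ → j ≡ j′
  joins-unique {j = j} {j′} (inj₁ (a , b)) (inj₁ (c , d)) =
    edge-inj j j′ (inj₁ (≡.trans a (≡.sym c) , ≡.trans b (≡.sym d)))
  joins-unique {j = j} {j′} (inj₁ (a , b)) (inj₂ (c , d)) =
    edge-inj j j′ (inj₂ (≡.trans a (≡.sym d) , ≡.trans b (≡.sym c)))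
  joins-unique {j = j} {j′} (inj₂ (a , b)) (inj₁ (c , d)) =
    edge-inj j j′ (inj₂ (≡.trans a (≡.sym d) , ≡.trans b (≡.sym c)))
  joins-unique {j = j} {j′} (inj₂ (a , b)) (inj₂ (c , d)) =
    edge-inj j j′ (inj₁ (≡.trans a (≡.sym c) , ≡.trans b (≡.sym d)))

  ¬Adj⇒¬Joins : ∀ {i k} j → ¬ Adj i k → ¬ Joins i k j
  ¬Adj⇒¬Joins j ¬adj (inj₁ (a , b)) = ¬adj (≡.subst₂ Adj a b (edge-adj j))
  ¬Adj⇒¬Joins j ¬adj (inj₂ (a , b)) = ¬adj (adj-sym (≡.subst₂ Adj a b (edge-adj j)))

module LaplacianFactorisation
  {c ℓ c′ ℓ′ : Level} (F : Field c ℓ) (K : Field c′ ℓ′) {ι : Field.Carrier F → Field.Carrier K}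
  (ι-hom : RingMorphisms.IsRingHomomorphism (Field.rawRing F) (Field.rawRing K) ι)
  {f : Field.Carrier F → Field.Carrier F} (f-aut : IsInvolutiveUnitAut F f)
  {n : ℕ} (G : SimpleGraph n) (Φ : SkewGain F f G) {m : ℕ} (E : OrientedEdges G m)
  (sq : Fin m → Field.Carrier K)
  (sq-square : ∀ j → Field._≈_ K (Field._*_ K (sq j) (sq j))
                 (ι (gmap F f (SkewGain.φ Φ (OrientedEdges.tl E j) (OrientedEdges.hd E j))))) where
  open SkewGainMatrices F K ι f G Φ E sq
  private module F = Field F
  open Field K
  open RingMorphisms.IsRingHomomorphism ι-hom using (⟦⟧-cong; *-homo)
  open IsInvolutiveUnitAut f-aut
  open SimpleGraph G
  open SkewGain Φ
  open OrientedEdges E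
  open FieldProperties K
  open RingHomomorphismProperties F K ι-hom
  open EdgeProperties G E

  φe≉0 : ∀ j → ¬ φe j F.≈ F.0#
  φe≉0 j = φ-nonzero (edge-adj j)

  fφe≉0 : ∀ j → ¬ f (φe j) F.≈ F.0#
  fφe≉0 j = f-unit (φe j) (φe≉0 j)

  sq≉0 : ∀ j → ¬ sq j ≈ 0#
  sq≉0 j = s*s≈a∧a≉0⇒s≉0 (sq-square j)
             (ι-nonzero (FieldProperties.x≉0∧y≉0⇒xy≉0 F (φe≉0 j) (fφe≉0 j)))

  entry : Fin n → Fin n → Fin m → Carrier
  entry i k j = incidence i j * incidence# j k

  entry-diagonal : ∀ i j → entry i i j ≈ incidentSq i j
  entry-diagonal i j with tl j ≟ i | hd j ≟ i
  ... | yes _ | _     = trans (*-congʳ (sym (sq-square j)))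
                              (s*t≈1⇒[x*s]*t≈x (sq j) (⁻¹-inverse (sq j) (sq≉0 j)))
  ... | no _  | yes _ = a*b≈1⇒[-a*s]*-b≈s (sq j) (ι-inverse (fφe≉0 j))
  ... | no _  | no _  = zeroˡ _

  entry-unjoined : ∀ {i k} j → i ≢ k → ¬ Joins i k j → entry i k j ≈ 0#
  entry-unjoined {i} {k} j i≢k ¬joins with tl j ≟ i | hd j ≟ i | tl j ≟ k | hd j ≟ k
  ... | yes p | _     | yes q | _     = ⊥-elim (i≢k (≡.trans (≡.sym p) q))
  ... | yes p | _     | no _  | yes q = ⊥-elim (¬joins (inj₁ (p , q)))
  ... | yes _ | _     | no _  | no _  = zeroʳ _
  ... | no _  | yes p | yes q | _     = ⊥-elim (¬joins (inj₂ (q , p)))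
  ... | no _  | yes p | no _  | yes q = ⊥-elim (i≢k (≡.trans (≡.sym p) q))
  ... | no _  | yes _ | no _  | no _  = zeroʳ _
  ... | no _  | no _  | _     | _     = zeroˡ _

  entry-forward : ∀ {i k} j → i ≢ k → tl j ≡ i → hd j ≡ k → entry i k j ≈ - ι (φ i k)
  entry-forward {i} {k} j i≢k tl≡i hd≡k with tl j ≟ i | tl j ≟ k | hd j ≟ k
  ... | no tl≢i | _      | _       = ⊥-elim (tl≢i tl≡i)
  ... | yes _   | yes q  | _       = ⊥-elim (i≢k (≡.trans (≡.sym tl≡i) q))
  ... | yes _   | no _   | no hd≢k = ⊥-elim (hd≢k hd≡k)
  ... | yes _   | no _   | yes _   = begin
    ι (φe j F.* f (φe j)) * (- ι (f (φe j) F.⁻¹))     ≈⟨ *-congʳ (*-homo (φe j) (f (φe j))) ⟩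
    (ι (φe j) * ι (f (φe j))) * (- ι (f (φe j) F.⁻¹)) ≈⟨ s*t≈1⇒[x*s]*-t≈-x (ι (φe j)) (ι-inverse (fφe≉0 j)) ⟩
    - ι (φe j)                                         ≡⟨ ≡.cong (λ x → - ι x) (cong₂ φ tl≡i hd≡k) ⟩
    - ι (φ i k)                                        ∎
    where
      open SetoidReasoning setoid

  entry-backward : ∀ {i k} j → i ≢ k → tl j ≡ k → hd j ≡ i → entry i k j ≈ - ι (φ i k)
  entry-backward {i} {k} j i≢k tl≡k hd≡i with tl j ≟ i | hd j ≟ i | tl j ≟ k
  ... | yes q | _       | _       = ⊥-elim (i≢k (≡.trans (≡.sym q) tl≡k))
  ... | no _  | no hd≢i | _       = ⊥-elim (hd≢i hd≡i)
  ... | no _  | yes _   | no tl≢k = ⊥-elim (tl≢k tl≡k)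
  ... | no _  | yes _   | yes _   =
    trans (s*t≈1⇒[x*s]*t≈x (- ι (f (φe j))) (⁻¹-inverse (sq j) (sq≉0 j))) (-‿cong fφe≈φ)
    where
      fφe≈φ : ι (f (φe j)) ≈ ι (φ i k)
      fφe≈φ = sym (⟦⟧-cong (F.trans (F.reflexive (cong₂ φ (≡.sym hd≡i) (≡.sym tl≡k)))
                                      (φ-skew (edge-adj j))))

  entry-joined : ∀ {i k} j → i ≢ k → Joins i k j → entry i k j ≈ - ι (φ i k)
  entry-joined j i≢k (inj₁ (tl≡i , hd≡k)) = entry-forward j i≢k tl≡i hd≡k
  entry-joined j i≢k (inj₂ (tl≡k , hd≡i)) = entry-backward j i≢k tl≡k hd≡i

  product-diagonal : ∀ i → (incidence ⊗ incidence#) i i ≈ ∑ K m (incidentSq i)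
  product-diagonal i = ∑-cong (entry-diagonal i)

  product-nonadjacent : ∀ {i k} → i ≢ k → ¬ Adj i k → (incidence ⊗ incidence#) i k ≈ 0#
  product-nonadjacent i≢k ¬adj = ∑-0 (λ j → entry-unjoined j i≢k (¬Adj⇒¬Joins j ¬adj))

  product-adjacent : ∀ {i k} → i ≢ k → Adj i k → (incidence ⊗ incidence#) i k ≈ - ι (φ i k)
  product-adjacent {i} {k} i≢k adj with edge-sur i k adj
  ... | j₀ , joins₀ = trans
    (∑-single j₀ (λ j j≢j₀ → entry-unjoined j i≢k (λ joins → j≢j₀ (joins-unique joins joins₀))))
    (entry-joined j₀ i≢k joins₀)

  laplacian≋incidence⊗incidence# : laplacian ≋ (incidence ⊗ incidence#)
  laplacian≋incidence⊗incidence# i k with i ≟ k | adj? i k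
  ... | yes ≡.refl | yes adj = ⊥-elim (irrefl i adj)
  ... | yes ≡.refl | no _    = trans (x-0≈x _) (sym (product-diagonal i))
  ... | no i≢k     | no ¬adj = trans (x-0≈x 0#) (sym (product-nonadjacent i≢k ¬adj))
  ... | no i≢k     | yes adj = trans (+-identityˡ _) (sym (product-adjacent i≢k adj))

mainTheorem9 : ∀ {c ℓ c' ℓ' : Level}
    (F : Field c ℓ) → CharZero F →
    (K : Field c' ℓ') (ι : Field.Carrier F → Field.Carrier K) → IsAlgebraicClosure F K ι →
    (f : Field.Carrier F → Field.Carrier F) → IsInvolutiveUnitAut F f →
    {n : ℕ} (G : SimpleGraph n) (Φ : SkewGain F f G) {m : ℕ} (E : OrientedEdges G m) →
    (sq : Fin m → Field.Carrier K) →
    (∀ j → Field._≈_ K (Field._*_ K (sq j) (sq j))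
             (ι (gmap F f (SkewGain.φ Φ (OrientedEdges.tl E j) (OrientedEdges.hd E j))))) →
    let open SkewGainMatrices F K ι f G Φ E sq in
    laplacian ≋ (incidence ⊗ incidence#)
mainTheorem9 F _ K ι closure f f-aut G Φ E sq sq-square =
  LaplacianFactorisation.laplacian≋incidence⊗incidence#
    F K (IsAlgebraicClosure.ι-hom closure) f-aut G Φ E sq sq-square
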